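{- Let $n\ge 0$ and let $a,b,t_0,\dots,t_n$ be distinct colors. For every $0\le i\le n$: if $abt_i\subseteq S$ and $I(t_i,\dots,t_n)\,a\,t_n\subseteq R$, then the state $(S,R)$ is unsortable. Furthermore, if $S'\subseteq abt_i$ and $R'\subseteq I(t_i,\dots,t_n)\,a\,t_n$ are such that $S'R'\neq abt_i\,I(t_i,\dots,t_n)\,a\,t_n$, then the state $(S',R')$ is foot-sortable.
   Context: Sock orderings are finite words of colored socks, written as words over colors. $Y\subseteq X$ means $Y$ is obtained from $X$ by deleting zero or more socks. A state $(S,R)$ consists of a stack content $S$ (read left to right = bottom to top) and remaining input $R$. A step either pushes the leftmost sock of $R$ onto the top of the stack or pops the top sock of the stack and appends it to the right of the output. $(S,R)$ is foot-sortable if some sequence of steps reaches $(\emptyset,\emptyset)$ with output in which all socks of each color are consecutive; otherwise unsortable. For distinct colors $t_i,\dots,t_n$, $I(t_i)$ is the empty word and for $n>i$, $I(t_i,\dots,t_n)=I(t_i,\dots,t_{n-1})\,t_nt_{n-1}=t_{i+1}t_it_{i+2}t_{i+1}\cdots t_nt_{n-1}$. -}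

module Defs where

open import Data.Nat using (ℕ; _<_)
open import Data.Fin using (Fin; toℕ)
open import Data.List using (List; []; _∷_; _++_; _∷ʳ_; length; lookup; drop; tabulate)
open import Data.Product using (Σ; _×_; _,_)
open import Relation.Binary.PropositionalEquality using (_≡_)
open import Relation.Binary.Construct.Closure.ReflexiveTransitive using (Star)
open import Relation.Nullary using (¬_)

-- A configuration: stack content (bottom to top, left to right),
-- remaining input, and output produced so far.
record Config (C : Set) : Set where
  constructor ⟨_,_,_⟩
  field
    stack  : List C
    input  : List C
    output : List C

data Step {C : Set} : Config C → Config C → Set where
  push : ∀ S x R out → Step ⟨ S , x ∷ R , out ⟩ ⟨ S ∷ʳ x , R , out ⟩
  pop  : ∀ S x R out → Step ⟨ S ∷ʳ x , R , out ⟩ ⟨ S , R , out ∷ʳ x ⟩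

Consecutive : {C : Set} → List C → Set
Consecutive w = ∀ (i j k : Fin (length w)) → toℕ i < toℕ j → toℕ j < toℕ k →
  lookup w i ≡ lookup w k → lookup w j ≡ lookup w i

FootSortable : {C : Set} → List C → List C → Set
FootSortable {C} S R = Σ (List C) λ out →
  Star Step ⟨ S , R , [] ⟩ ⟨ [] , [] , out ⟩ × Consecutive out

Unsortable : {C : Set} → List C → List C → Set
Unsortable S R = ¬ FootSortable S R

Iw : {C : Set} → List C → List C
Iw (x ∷ y ∷ rest) = y ∷ x ∷ Iw (y ∷ rest)
Iw _ = []

tsFrom : {C : Set} {n : ℕ} → (Fin n → C) → Fin n → List C
tsFrom {n = n} t i = drop (toℕ i) (tabulate t)

module Submission where

-- Deleting socks preserves foot-sortability: a run of (S, R) is simulated on (S′, R′) by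
-- skipping the steps that move deleted socks, and the output only loses socks. Both claims
-- therefore reduce to extreme states.
--
-- Unsortability of (a b tᵢ, I(tᵢ,…,tₙ) a tₙ): when b is popped, the input has been cut into
-- a consumed part P and a remaining part Q; tᵢ and the socks of P leave before b, while a and
-- the socks of Q leave after it. Every such cut leaves some colour x ≠ b on both sides, so
-- the output contains x b x.
--
-- Sortability of the maximal proper substates: with tⱼ on top of the stack, each pair
-- tⱼ₊₁ tⱼ of I is absorbed by popping tⱼ, pushing tⱼ₊₁, and pushing and popping tⱼ. The
-- explicit runs built this way output a subword of a word in which every colour forms one
-- block of two socks.

open import Defs
open import Data.Nat using (ℕ; zero; suc; _<_; s≤s; z≤n)
open import Data.Fin using (Fin; fromℕ; toℕ) renaming (zero to fzero; suc to fsuc)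
open import Data.List
  using (List; []; _∷_; _++_; _∷ʳ_; length; lookup; tabulate; removeAt; initLast; _∷ʳ′_)
open import Data.List.Properties using (++-assoc; ++-identityʳ; ∷ʳ-injective; ∷-injective)
open import Data.List.Membership.Propositional using (_∈_; _∉_)
open import Data.List.Membership.Propositional.Properties using (∈-lookup)
open import Data.List.Relation.Unary.Any using (here; there)
open import Data.List.Relation.Unary.All using (_∷_)
import Data.List.Relation.Unary.All.Properties as All
open import Data.List.Relation.Unary.AllPairs using ([]; _∷_)
open import Data.List.Relation.Unary.Unique.Propositional using (Unique)
open import Data.List.Relation.Unary.Unique.Propositional.Properties
  using (Unique[x∷xs]⇒x∉xs)
import Data.List.Relation.Unary.Unique.Propositional.Properties as Unique
open import Data.List.Relation.Binary.Sublist.Propositional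
  using (_⊆_; []; _∷_; ⊆-refl; minimum; from∈)
  renaming (_∷ʳ_ to skip)
import Data.List.Relation.Binary.Sublist.Propositional as Sublist
open import Data.List.Relation.Binary.Sublist.Propositional.Properties using (++⁺; ++⁺ʳ)
open import Data.List.Relation.Binary.Permutation.Propositional
  using (_↭_; ↭-refl; ↭-sym; ↭-trans; ↭-reflexive; prep; swap; ↭⇒↭ₛ)
open import Data.List.Relation.Binary.Permutation.Propositional.Properties
  using (shift; ++-comm; ∈-resp-↭; ∷↭∷ʳ)
import Data.List.Relation.Binary.Permutation.Propositional.Properties as ↭
import Data.List.Relation.Binary.Permutation.Setoid.Properties as ↭ₛ
open import Data.Product using (∃-syntax; _×_; _,_)
import Data.Product as Product
open import Data.Sum using (_⊎_; inj₁; inj₂)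
open import Data.Empty using (⊥-elim)
open import Function using (_∘_)
open import Function.Definitions using (Injective)
open import Relation.Binary.PropositionalEquality
  using (_≡_; _≢_; refl; sym; trans; cong; subst; setoid; module ≡-Reasoning)
open import Relation.Binary.Construct.Closure.ReflexiveTransitive using (Star; ε; _◅_; _◅◅_)
open import Relation.Nullary using (¬_)

module _ {C : Set} where

  ⊆-∷ʳ⁻ : ∀ (xs : List C) {ys x} → ys ⊆ xs ∷ʳ x →
          ys ⊆ xs ⊎ ∃[ ys′ ] ys ≡ ys′ ∷ʳ x × ys′ ⊆ xs
  ⊆-∷ʳ⁻ []       (skip _ p)  = inj₁ p
  ⊆-∷ʳ⁻ []       (refl ∷ []) = inj₂ ([] , refl , [])
  ⊆-∷ʳ⁻ (z ∷ xs) (skip _ p) with ⊆-∷ʳ⁻ xs p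
  ... | inj₁ q                = inj₁ (skip z q)
  ... | inj₂ (ys′ , refl , q) = inj₂ (ys′ , refl , skip z q)
  ⊆-∷ʳ⁻ (z ∷ xs) (refl ∷ p) with ⊆-∷ʳ⁻ xs p
  ... | inj₁ q                = inj₁ (refl ∷ q)
  ... | inj₂ (ys′ , refl , q) = inj₂ (z ∷ ys′ , refl , refl ∷ q)

  ⊂⇒⊆-removeAt : ∀ {xs ys : List C} → xs ⊆ ys → xs ≢ ys → ∃[ i ] xs ⊆ removeAt ys i
  ⊂⇒⊆-removeAt []         xs≢ys = ⊥-elim (xs≢ys refl)
  ⊂⇒⊆-removeAt (skip _ p) _     = fzero , p
  ⊂⇒⊆-removeAt (refl ∷ p) xs≢ys =
    Product.map fsuc (refl ∷_) (⊂⇒⊆-removeAt p (xs≢ys ∘ cong (_ ∷_)))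

  ⊆-index : ∀ {xs ys : List C} → xs ⊆ ys → Fin (length xs) → Fin (length ys)
  ⊆-index (skip _ p) i        = fsuc (⊆-index p i)
  ⊆-index (refl ∷ p) fzero    = fzero
  ⊆-index (refl ∷ p) (fsuc i) = fsuc (⊆-index p i)

  lookup-⊆-index : ∀ {xs ys : List C} (p : xs ⊆ ys) i → lookup ys (⊆-index p i) ≡ lookup xs i
  lookup-⊆-index (skip _ p) i        = lookup-⊆-index p i
  lookup-⊆-index (refl ∷ p) fzero    = refl
  lookup-⊆-index (refl ∷ p) (fsuc i) = lookup-⊆-index p i

  ⊆-index-mono : ∀ {xs ys : List C} (p : xs ⊆ ys) {i j} →
                 toℕ i < toℕ j → toℕ (⊆-index p i) < toℕ (⊆-index p j)
  ⊆-index-mono (skip _ p) i<j                          = s≤s (⊆-index-mono p i<j)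
  ⊆-index-mono (refl ∷ p) {fzero}  {fsuc j} _         = s≤s z≤n
  ⊆-index-mono (refl ∷ p) {fsuc i} {fsuc j} (s≤s i<j) = s≤s (⊆-index-mono p i<j)

  Consecutive-⊆ : ∀ {xs ys : List C} → xs ⊆ ys → Consecutive ys → Consecutive xs
  Consecutive-⊆ {xs} {ys} p consec i j k i<j j<k xsᵢ≡xsₖ = begin
    lookup xs j      ≡⟨ sym (lookup-⊆-index p j) ⟩
    lookup ys (ι j)  ≡⟨ consec (ι i) (ι j) (ι k) (⊆-index-mono p i<j) (⊆-index-mono p j<k) ysᵢ≡ysₖ ⟩
    lookup ys (ι i)  ≡⟨ lookup-⊆-index p i ⟩
    lookup xs i      ∎
    where
    open ≡-Reasoning
    ι = ⊆-index p
    ysᵢ≡ysₖ : lookup ys (ι i) ≡ lookup ys (ι k)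
    ysᵢ≡ysₖ = trans (lookup-⊆-index p i) (trans xsᵢ≡xsₖ (sym (lookup-⊆-index p k)))

  ¬Consecutive-xyx : ∀ {x y : C} → x ≢ y → ¬ Consecutive (x ∷ y ∷ x ∷ [])
  ¬Consecutive-xyx x≢y consec =
    x≢y (sym (consec fzero (fsuc fzero) (fsuc (fsuc fzero)) (s≤s z≤n) (s≤s (s≤s z≤n)) refl))

  Consecutive-∷-fresh : ∀ {x : C} {w} → x ∉ w → Consecutive w → Consecutive (x ∷ w)
  Consecutive-∷-fresh x∉w consec fzero (fsuc j) (fsuc k) _ _ x≡wₖ =
    ⊥-elim (x∉w (subst (_∈ _) (sym x≡wₖ) (∈-lookup k)))
  Consecutive-∷-fresh x∉w consec (fsuc i) (fsuc j) (fsuc k) (s≤s i<j) (s≤s j<k) wᵢ≡wₖ =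
    consec i j k i<j j<k wᵢ≡wₖ

  Consecutive-∷-repeat : ∀ {x : C} {w} → Consecutive (x ∷ w) → Consecutive (x ∷ x ∷ w)
  Consecutive-∷-repeat consec fzero (fsuc fzero) (fsuc k) _ _ _ = refl
  Consecutive-∷-repeat consec fzero (fsuc (fsuc j)) (fsuc k) _ (s≤s j<k) x≡wₖ =
    consec fzero (fsuc j) k (s≤s z≤n) j<k x≡wₖ
  Consecutive-∷-repeat consec (fsuc i) (fsuc j) (fsuc k) (s≤s i<j) (s≤s j<k) wᵢ≡wₖ =
    consec i j k i<j j<k wᵢ≡wₖ

  doubles : List C → List C
  doubles []       = []
  doubles (x ∷ xs) = x ∷ x ∷ doubles xs

  ∈-doubles⁻ : ∀ {x : C} xs → x ∈ doubles xs → x ∈ xs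
  ∈-doubles⁻ (y ∷ ys) (here x≡y)         = here x≡y
  ∈-doubles⁻ (y ∷ ys) (there (here x≡y)) = here x≡y
  ∈-doubles⁻ (y ∷ ys) (there (there m))  = there (∈-doubles⁻ ys m)

  doubles-++⁺ : ∀ xs {ys zs : List C} → ys ⊆ doubles zs → doubles xs ++ ys ⊆ doubles (xs ++ zs)
  doubles-++⁺ []       p = p
  doubles-++⁺ (x ∷ xs) p = refl ∷ refl ∷ doubles-++⁺ xs p

  Consecutive-doubles : ∀ {xs : List C} → Unique xs → Consecutive (doubles xs)
  Consecutive-doubles []                = λ ()
  Consecutive-doubles {x ∷ xs} u@(_ ∷ u′) =
    Consecutive-∷-repeat
      (Consecutive-∷-fresh (Unique[x∷xs]⇒x∉xs u ∘ ∈-doubles⁻ xs) (Consecutive-doubles u′))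

  Unique-resp-↭ : ∀ {xs ys : List C} → xs ↭ ys → Unique xs → Unique ys
  Unique-resp-↭ p = ↭ₛ.Unique-resp-↭ (setoid C) (↭⇒↭ₛ p)

  run-⊆ : ∀ {S R o out S′ R′ o′ : List C} → Star Step ⟨ S , R , o ⟩ ⟨ [] , [] , out ⟩ →
          S′ ⊆ S → R′ ⊆ R → o′ ⊆ o →
          ∃[ out′ ] out′ ⊆ out × Star Step ⟨ S′ , R′ , o′ ⟩ ⟨ [] , [] , out′ ⟩
  run-⊆ ε [] [] o′⊆o = _ , o′⊆o , ε
  run-⊆ (push S x R o ◅ run) S′⊆S (skip _ R′⊆R) o′⊆o =
    run-⊆ run (++⁺ʳ (x ∷ []) S′⊆S) R′⊆R o′⊆o
  run-⊆ {S′ = S′} {o′ = o′} (push S x R o ◅ run) S′⊆S (_∷_ {xs = R′} refl R′⊆R) o′⊆o =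
    Product.map₂ (Product.map₂ (push S′ x R′ o′ ◅_))
      (run-⊆ run (++⁺ S′⊆S (refl ∷ [])) R′⊆R o′⊆o)
  run-⊆ {R′ = R′} {o′ = o′} (pop S x R o ◅ run) S′⊆S R′⊆R o′⊆o with ⊆-∷ʳ⁻ S S′⊆S
  ... | inj₁ S′⊆S₀ = run-⊆ run S′⊆S₀ R′⊆R (++⁺ʳ (x ∷ []) o′⊆o)
  ... | inj₂ (S″ , refl , S″⊆S) =
    Product.map₂ (Product.map₂ (pop S″ x R′ o′ ◅_))
      (run-⊆ run S″⊆S R′⊆R (++⁺ o′⊆o (refl ∷ [])))

  FootSortable-⊆ : ∀ {S R S′ R′ : List C} →
                   FootSortable S R → S′ ⊆ S → R′ ⊆ R → FootSortable S′ R′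
  FootSortable-⊆ (out , run , consec) S′⊆S R′⊆R =
    let out′ , out′⊆out , run′ = run-⊆ run S′⊆S R′⊆R []
    in out′ , run′ , Consecutive-⊆ out′⊆out consec

  ∷ʳ-++-↭ : ∀ (S : List C) x R → (S ∷ʳ x) ++ R ↭ x ∷ S ++ R
  ∷ʳ-++-↭ S x R = ↭.++⁺ʳ R (↭-sym (∷↭∷ʳ x S))

  run-rest-↭ : ∀ {S R o out : List C} → Star Step ⟨ S , R , o ⟩ ⟨ [] , [] , out ⟩ →
               ∃[ Z ] out ≡ o ++ Z × S ++ R ↭ Z
  run-rest-↭ {o = o} ε = [] , sym (++-identityʳ o) , ↭-refl
  run-rest-↭ (push S x R o ◅ run) =
    let Z , out≡ , ↭Z = run-rest-↭ run
    in Z , out≡ , ↭-trans (↭-reflexive (sym (++-assoc S (x ∷ []) R))) ↭Z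
  run-rest-↭ (pop S x R o ◅ run) =
    let Z , out≡ , ↭Z = run-rest-↭ run
    in x ∷ Z , trans out≡ (++-assoc o (x ∷ []) Z) , ↭-trans (∷ʳ-++-↭ S x R) (prep x ↭Z)

  ∷ʳ≡++∷-cases : ∀ {S : List C} {x b} S₀ S₁ → S ∷ʳ x ≡ S₀ ++ b ∷ S₁ →
                 (S₁ ≡ [] × x ≡ b × S ≡ S₀) ⊎ ∃[ S₁′ ] S₁ ≡ S₁′ ∷ʳ x × S ≡ S₀ ++ b ∷ S₁′
  ∷ʳ≡++∷-cases {S} S₀ S₁ eq with initLast S₁
  ... | [] = let S≡S₀ , x≡b = ∷ʳ-injective S S₀ eq in inj₁ (refl , x≡b , S≡S₀)
  ∷ʳ≡++∷-cases {S} {b = b} S₀ _ eq | S₁′ ∷ʳ′ y =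
    let S≡ , x≡y = ∷ʳ-injective S (S₀ ++ b ∷ S₁′) (trans eq (sym (++-assoc S₀ (b ∷ S₁′) (y ∷ []))))
    in inj₂ (S₁′ , cong (S₁′ ∷ʳ_) (sym x≡y) , S≡)

  pop-split : ∀ {S R o out : List C} b S₀ S₁ → S ≡ S₀ ++ b ∷ S₁ →
              Star Step ⟨ S , R , o ⟩ ⟨ [] , [] , out ⟩ →
              ∃[ P ] ∃[ Q ] ∃[ X ] ∃[ Y ]
                R ≡ P ++ Q × out ≡ o ++ X ++ b ∷ Y × S₁ ++ P ↭ X × S₀ ++ Q ↭ Y
  pop-split b []      S₁ () ε
  pop-split b (_ ∷ _) S₁ () ε
  pop-split b S₀ S₁ eq (push S x R o ◅ run) =
    let P , Q , X , Y , R≡ , out≡ , X↭ , Y↭ =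
          pop-split b S₀ (S₁ ∷ʳ x) (trans (cong (_∷ʳ x) eq) (++-assoc S₀ (b ∷ S₁) (x ∷ []))) run
    in x ∷ P , Q , X , Y , cong (x ∷_) R≡ , out≡ ,
       ↭-trans (↭-reflexive (sym (++-assoc S₁ (x ∷ []) P))) X↭ , Y↭
  pop-split b S₀ S₁ eq (pop S x R o ◅ run) with ∷ʳ≡++∷-cases S₀ S₁ eq
  ... | inj₁ (refl , refl , refl) =
    let Z , out≡ , Z↭ = run-rest-↭ run
    in [] , R , [] , Z , refl , trans out≡ (++-assoc o (b ∷ []) Z) , ↭-refl , Z↭
  ... | inj₂ (S₁′ , refl , S≡) =
    let P , Q , X , Y , R≡ , out≡ , X↭ , Y↭ = pop-split b S₀ S₁′ S≡ run
    in P , Q , x ∷ X , Y , R≡ , trans out≡ (++-assoc o (x ∷ []) (X ++ b ∷ Y)) ,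
       ↭-trans (∷ʳ-++-↭ S₁′ x P) (prep x X↭) , Y↭

  -- A run is quantified over the output already produced, so runs compose by
  -- concatenating what they emit.
  infix  2 _⟶[_]_
  infixr 3 _▹_

  _⟶[_]_ : List C × List C → List C → List C × List C → Set
  (S , R) ⟶[ w ] (S′ , R′) = ∀ o → Star Step ⟨ S , R , o ⟩ ⟨ S′ , R′ , o ++ w ⟩

  _▹_ : ∀ {A B D w w′} → A ⟶[ w ] B → B ⟶[ w′ ] D → A ⟶[ w ++ w′ ] D
  _▹_ {S , R} {D = S″ , R″} {w} {w′} r r′ o =
    subst (λ out → Star Step ⟨ S , R , o ⟩ ⟨ S″ , R″ , out ⟩) (++-assoc o w w′) (r o ◅◅ r′ (o ++ w))

  push¹ : ∀ {S x R} → (S , x ∷ R) ⟶[ [] ] (S ∷ʳ x , R)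
  push¹ {S} {x} {R} o rewrite ++-identityʳ o = push S x R o ◅ ε

  pop¹ : ∀ S {x R} → (S ∷ʳ x , R) ⟶[ x ∷ [] ] (S , R)
  pop¹ S {x} {R} o = pop S x R o ◅ ε

  advance : ∀ S {t u R} → (S ∷ʳ t , u ∷ t ∷ R) ⟶[ t ∷ t ∷ [] ] (S ∷ʳ u , R)
  advance S {u = u} = pop¹ S ▹ push¹ ▹ push¹ ▹ pop¹ (S ∷ʳ u)

  lastOf : C → List C → C
  lastOf t []         = t
  lastOf _ (u ∷ rest) = lastOf u rest

module _ {C : Set} (a b : C) where

  inputWord : C → List C → List C
  inputWord t rest = Iw (t ∷ rest) ++ a ∷ lastOf t rest ∷ []

  split-witness : ∀ t rest P Q → P ++ Q ≡ inputWord t rest →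
                  ∃[ x ] x ∈ t ∷ P × x ∈ a ∷ Q × x ∈ a ∷ t ∷ rest
  split-witness t []       []      _ refl =
    t , here refl , there (there (here refl)) , there (here refl)
  split-witness t []       (_ ∷ _) _ eq   =
    a , there (here (sym (Product.proj₁ (∷-injective eq)))) , here refl , here refl
  split-witness t (u ∷ _)  []      _ refl =
    t , here refl , there (there (here refl)) , there (here refl)
  split-witness t (u ∷ _)  (_ ∷ []) _ refl = t , here refl , there (here refl) , there (here refl)
  split-witness t (u ∷ rest) (_ ∷ _ ∷ P) Q eq
    with refl , eq′ ← ∷-injective eq
    with refl , eq″ ← ∷-injective eq′ =
    let x , x∈uP , x∈aQ , x∈ = split-witness u rest P Q eq″
    in x , Sublist.lookup (skip t (refl ∷ skip t ⊆-refl)) x∈uP , x∈aQ ,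
       Sublist.lookup (refl ∷ skip t ⊆-refl) x∈

  unsortable-minimal : ∀ t rest → b ∉ a ∷ t ∷ rest → Unsortable (a ∷ b ∷ t ∷ []) (inputWord t rest)
  unsortable-minimal t rest b∉ (out , run , consec)
    with P , Q , X , Y , R≡ , out≡ , X↭ , Y↭ ← pop-split b (a ∷ []) (t ∷ []) refl run
    with x , x∈tP , x∈aQ , x∈ ← split-witness t rest P Q (sym R≡) =
    ¬Consecutive-xyx x≢b (Consecutive-⊆ xbx⊆out consec)
    where
    x≢b : x ≢ b
    x≢b refl = b∉ x∈
    xbx⊆out : x ∷ b ∷ x ∷ [] ⊆ out
    xbx⊆out = subst (x ∷ b ∷ x ∷ [] ⊆_) (sym out≡)
      (++⁺ (from∈ (∈-resp-↭ X↭ x∈tP)) (refl ∷ from∈ (∈-resp-↭ Y↭ x∈aQ)))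

  unsortable-above : ∀ t rest → Unique (a ∷ b ∷ t ∷ rest) → ∀ S R →
                     a ∷ b ∷ t ∷ [] ⊆ S → inputWord t rest ⊆ R → Unsortable S R
  unsortable-above t rest u S R S⊇ R⊇ sortable =
    unsortable-minimal t rest (Unique[x∷xs]⇒x∉xs (Unique-resp-↭ (swap a b ↭-refl) u))
      (FootSortable-⊆ sortable S⊇ R⊇)

  sortFrom : ∀ x t rest →
             (x ∷ t ∷ [] , inputWord t rest) ⟶[ doubles (t ∷ rest) ++ a ∷ x ∷ [] ] ([] , [])
  sortFrom x t []         =
    pop¹ (x ∷ []) ▹ push¹ ▹ push¹ ▹ pop¹ (x ∷ a ∷ []) ▹ pop¹ (x ∷ []) ▹ pop¹ []
  sortFrom x t (u ∷ rest) = advance (x ∷ []) ▹ sortFrom x u rest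

  sortFrom-a : ∀ t rest → (a ∷ [] , inputWord t rest) ⟶[ t ∷ doubles rest ++ a ∷ a ∷ [] ] ([] , [])
  sortFrom-a t []         = push¹ ▹ push¹ ▹ pop¹ (a ∷ a ∷ []) ▹ pop¹ (a ∷ []) ▹ pop¹ []
  sortFrom-a t (u ∷ rest) = push¹ ▹ push¹ ▹ pop¹ (a ∷ u ∷ []) ▹ sortFrom a u rest

  record BlockSort (S R ts : List C) : Set where
    constructor blockSort
    field
      blocks  : List C
      blocks↭ : blocks ↭ a ∷ b ∷ ts
      output  : List C
      output⊆ : output ⊆ doubles blocks
      run     : (S , R) ⟶[ output ] ([] , [])

  BlockSort⇒FootSortable : ∀ {S R ts} → Unique (a ∷ b ∷ ts) → BlockSort S R ts → FootSortable S R
  BlockSort⇒FootSortable u (blockSort D D↭ w w⊆ run) =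
    w , run [] , Consecutive-⊆ w⊆ (Consecutive-doubles (Unique-resp-↭ (↭-sym D↭) u))

  blockSort-bt : ∀ t rest → BlockSort (b ∷ t ∷ []) (inputWord t rest) (t ∷ rest)
  blockSort-bt t rest = blockSort ((t ∷ rest) ++ a ∷ b ∷ []) (++-comm (t ∷ rest) (a ∷ b ∷ [])) _
    (doubles-++⁺ (t ∷ rest) (refl ∷ skip a (refl ∷ skip b []))) (sortFrom b t rest)

  blockSort-at : ∀ t rest → BlockSort (a ∷ t ∷ []) (inputWord t rest) (t ∷ rest)
  blockSort-at t rest = blockSort ((t ∷ rest) ++ a ∷ b ∷ []) (++-comm (t ∷ rest) (a ∷ b ∷ [])) _
    (doubles-++⁺ (t ∷ rest) (refl ∷ refl ∷ minimum _)) (sortFrom a t rest)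

  blockSort-ab : ∀ t rest → BlockSort (a ∷ b ∷ []) (inputWord t rest) (t ∷ rest)
  blockSort-ab t rest = blockSort (b ∷ t ∷ rest ++ a ∷ []) (++-comm (b ∷ t ∷ rest) (a ∷ [])) _
    (refl ∷ skip b (refl ∷ skip t (doubles-++⁺ rest ⊆-refl))) (pop¹ (a ∷ []) ▹ sortFrom-a t rest)

  blockSort-abt : ∀ t rest {R w} → w ⊆ doubles (t ∷ b ∷ rest ++ a ∷ []) →
                  (a ∷ b ∷ t ∷ [] , R) ⟶[ w ] ([] , []) → BlockSort (a ∷ b ∷ t ∷ []) R (t ∷ rest)
  blockSort-abt t rest = blockSort (t ∷ b ∷ rest ++ a ∷ [])
    (↭-trans (++-comm (t ∷ b ∷ rest) (a ∷ [])) (prep a (swap t b ↭-refl))) _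

  blockSort-removeAt : ∀ t rest (i : Fin (length (inputWord t rest))) →
                       BlockSort (a ∷ b ∷ t ∷ []) (removeAt (inputWord t rest) i) (t ∷ rest)
  blockSort-removeAt t [] fzero = blockSort-abt t []
    (refl ∷ refl ∷ refl ∷ skip b (refl ∷ skip a []))
    (push¹ ▹ pop¹ (a ∷ b ∷ t ∷ []) ▹ pop¹ (a ∷ b ∷ []) ▹ pop¹ (a ∷ []) ▹ pop¹ [])
  blockSort-removeAt t [] (fsuc fzero) = blockSort-abt t []
    (refl ∷ skip t (refl ∷ skip b (refl ∷ refl ∷ [])))
    (pop¹ (a ∷ b ∷ []) ▹ pop¹ (a ∷ []) ▹ push¹ ▹ pop¹ (a ∷ []) ▹ pop¹ [])
  blockSort-removeAt t (u ∷ rest) fzero = blockSort-abt t (u ∷ rest)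
    (refl ∷ refl ∷ refl ∷ skip b (refl ∷ skip u (doubles-++⁺ rest ⊆-refl)))
    (push¹ ▹ pop¹ (a ∷ b ∷ t ∷ []) ▹ pop¹ (a ∷ b ∷ []) ▹ pop¹ (a ∷ []) ▹ sortFrom-a u rest)
  blockSort-removeAt t (u ∷ rest) (fsuc fzero) = blockSort-abt t (u ∷ rest)
    (refl ∷ skip t (refl ∷ skip b (refl ∷ refl ∷ doubles-++⁺ rest ⊆-refl)))
    (pop¹ (a ∷ b ∷ []) ▹ pop¹ (a ∷ []) ▹ push¹ ▹ sortFrom a u rest)
  blockSort-removeAt t (u ∷ rest) (fsuc (fsuc i)) =
    let blockSort D D↭ _ w⊆ run = blockSort-removeAt u rest i
    in blockSort (t ∷ D) (↭-trans (prep t D↭) (↭-sym (shift t (a ∷ b ∷ []) (u ∷ rest)))) _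
         (refl ∷ refl ∷ w⊆) (advance (a ∷ b ∷ []) ▹ run)

  footSortable-below : ∀ t rest → Unique (a ∷ b ∷ t ∷ rest) → ∀ S′ R′ →
                       S′ ⊆ a ∷ b ∷ t ∷ [] → R′ ⊆ inputWord t rest →
                       S′ ++ R′ ≢ (a ∷ b ∷ t ∷ []) ++ inputWord t rest → FootSortable S′ R′
  footSortable-below t rest u S′ R′ (skip _ S′⊆) R′⊆ _ =
    FootSortable-⊆ (BlockSort⇒FootSortable u (blockSort-bt t rest)) S′⊆ R′⊆
  footSortable-below t rest u S′ R′ (refl ∷ skip _ S′⊆) R′⊆ _ =
    FootSortable-⊆ (BlockSort⇒FootSortable u (blockSort-at t rest)) (refl ∷ S′⊆) R′⊆
  footSortable-below t rest u S′ R′ (refl ∷ refl ∷ skip _ S′⊆) R′⊆ _ =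
    FootSortable-⊆ (BlockSort⇒FootSortable u (blockSort-ab t rest)) (refl ∷ refl ∷ S′⊆) R′⊆
  footSortable-below t rest u S′ R′ (refl ∷ refl ∷ refl ∷ []) R′⊆ S′R′≢ =
    let i , R′⊆R∖i = ⊂⇒⊆-removeAt R′⊆ (S′R′≢ ∘ cong ((a ∷ b ∷ t ∷ []) ++_))
    in FootSortable-⊆ (BlockSort⇒FootSortable u (blockSort-removeAt t rest i)) ⊆-refl R′⊆R∖i

lastOf-tabulate : ∀ {C : Set} n (t : Fin (suc n) → C) →
                  lastOf (t fzero) (tabulate (t ∘ fsuc)) ≡ t (fromℕ n)
lastOf-tabulate zero    t = refl
lastOf-tabulate (suc n) t = lastOf-tabulate n (t ∘ fsuc)

tsFrom-view : ∀ {C : Set} n (t : Fin (suc n) → C) i →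
              ∃[ rest ] tsFrom t i ≡ t i ∷ rest × lastOf (t i) rest ≡ t (fromℕ n)
tsFrom-view n       t fzero    = tabulate (t ∘ fsuc) , refl , lastOf-tabulate n t
tsFrom-view (suc n) t (fsuc i) = tsFrom-view n (t ∘ fsuc) i

Unique-tsFrom : ∀ {C : Set} {n} {t : Fin n → C} {a b} → Injective _≡_ _≡_ t → a ≢ b →
                (∀ j → a ≢ t j) → (∀ j → b ≢ t j) → ∀ i → Unique (a ∷ b ∷ tsFrom t i)
Unique-tsFrom t-inj a≢b a∉t b∉t i =
  (a≢b ∷ All.drop⁺ (toℕ i) (All.tabulate⁺ a∉t)) ∷
  All.drop⁺ (toℕ i) (All.tabulate⁺ b∉t) ∷ Unique.drop⁺ (toℕ i) (Unique.tabulate⁺ t-inj)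

mainTheorem2 : {C : Set} (n : ℕ) (t : Fin (ℕ.suc n) → C) (a b : C) →
    Injective _≡_ _≡_ t → a ≢ b → (∀ j → a ≢ t j) → (∀ j → b ≢ t j) →
    (i : Fin (ℕ.suc n)) →
    (∀ (S R : List C) → (a ∷ b ∷ t i ∷ []) ⊆ S →
        (Iw (tsFrom t i) ++ a ∷ t (fromℕ n) ∷ []) ⊆ R → Unsortable S R)
    ×
    (∀ (S′ R′ : List C) → S′ ⊆ (a ∷ b ∷ t i ∷ []) →
        R′ ⊆ (Iw (tsFrom t i) ++ a ∷ t (fromℕ n) ∷ []) →
        S′ ++ R′ ≢ (a ∷ b ∷ t i ∷ []) ++ (Iw (tsFrom t i) ++ a ∷ t (fromℕ n) ∷ []) →
        FootSortable S′ R′)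
mainTheorem2 n t a b t-inj a≢b a∉t b∉t i
  with tsFrom t i | Unique-tsFrom t-inj a≢b a∉t b∉t i | tsFrom-view n t i
... | _ | uniq | rest , refl , last≡ rewrite sym last≡ =
  unsortable-above a b (t i) rest uniq , footSortable-below a b (t i) rest uniq
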